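{- Let $S$ be a weighted system as below and let $S'$ be the system obtained from $S$ by first applying Rule 1 as long as possible and then applying Rule 2 as long as possible. Then $S'$ is irreducible.
   Context: A weighted system $S$ consists of equations $\prod_{i\in I_j}x_i=b_j$, $j=1,\dots,m$, in variables $x_1,\dots,x_n$, where $\emptyset\ne I_j\subseteq[n]$, $x_i,b_j\in\{ -1,1\}$, and equation $j$ has a positive integral weight $w_j$. Rule 1: if for some $I\subseteq[n]$ there are two equations $\prod_{i\in I}x_i=b'$ with weight $w'$ and $\prod_{i\in I}x_i=b''$ with weight $w''$, replace this pair by one of these equations with weight $w'+w''$ if $b'=b''$, and otherwise by the equation of larger weight with new weight equal to the difference of the two weights; if the resulting weight is $0$, delete the equation. Rule 2: let $A$ be the $m\times n$ matrix over $\mathbb{F}_2$ with $a_{ji}=1$ iff $i\in I_j$; let $t=\mathrm{rank}A$ and let columns $a^{i_1},\dots,a^{i_t}$ of $A$ be linearly independent; delete all variables not in $\{x_{i_1},\dots,x_{i_t}\}$ from the equations of $S$. A system is irreducible if it cannot be changed by Rule 1 or Rule 2. -}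

module Defs where

open import Data.Nat using (ℕ; _+_; _∸_; _<_; _≤_; _<ᵇ_; _%_)
open import Data.Bool using (Bool; true; false; if_then_else_; _xor_; not)
open import Data.Fin.Subset using (Subset; _⊆_; _∩_; ∣_∣; Nonempty)
open import Data.List using (List; []; _∷_; [_]; _++_; map)
open import Data.List.Relation.Unary.All using (All)
open import Data.List.Relation.Unary.Any using (Any)
open import Data.List.Relation.Binary.Permutation.Propositional using (_↭_)
open import Data.Product using (_×_; Σ-syntax)
open import Relation.Binary.PropositionalEquality using (_≡_)

-- An equation  ∏_{i ∈ I} x_i = b  with weight w, in variables x_0 … x_{n-1}.
-- The sign b ∈ {-1,1} is encoded as a Bool (true ↔ 1, false ↔ -1).
record Equation (n : ℕ) : Set where
  constructor eqn
  field
    I : Subset n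
    b : Bool
    w : ℕ
open Equation public

-- A weighted system: a finite list (multiset, up to ↭) of equations.
System : ℕ → Set
System n = List (Equation n)

WellFormedEq : ∀ {n} → Equation n → Set
WellFormedEq e = Nonempty (I e) × 0 < w e

WellFormed : ∀ {n} → System n → Set
WellFormed S = All WellFormedEq S

combine : ∀ {n} → Equation n → Equation n → System n
combine (eqn I b₁ w₁) (eqn _ b₂ w₂) =
  if not (b₁ xor b₂) then [ eqn I b₁ (w₁ + w₂) ]
  else (if w₂ <ᵇ w₁ then [ eqn I b₁ (w₁ ∸ w₂) ]
        else (if w₁ <ᵇ w₂ then [ eqn I b₂ (w₂ ∸ w₁) ] else []))

Rule1Step : ∀ {n} → System n → System n → Set
Rule1Step {n} S T =
  Σ[ e₁ ∈ Equation n ] Σ[ e₂ ∈ Equation n ] Σ[ R ∈ System n ]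
    (S ↭ (e₁ ∷ e₂ ∷ R)) × (I e₁ ≡ I e₂) × (T ↭ (combine e₁ e₂ ++ R))

-- Columns of the F₂-matrix A (rows = equations, a_{ji} = 1 iff i ∈ I_j).
-- A set L of columns sums to a nonzero vector iff some row j has |I_j ∩ L| odd.
SumNonzero : ∀ {n} → System n → Subset n → Set
SumNonzero S L = Any (λ e → ∣ I e ∩ L ∣ % 2 ≡ 1) S

Independent : ∀ {n} → System n → Subset n → Set
Independent S K = ∀ L → L ⊆ K → Nonempty L → SumNonzero S L

-- K is a set of t = rank A linearly independent columns
-- (rank = maximum size of an independent set of columns).
RankIndependent : ∀ {n} → System n → Subset n → Set
RankIndependent S K = Independent S K × (∀ K' → Independent S K' → ∣ K' ∣ ≤ ∣ K ∣)

restrict : ∀ {n} → Subset n → Equation n → Equation n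
restrict K (eqn I b w) = eqn (I ∩ K) b w

Rule2Step : ∀ {n} → System n → System n → Set
Rule2Step {n} S T = Σ[ K ∈ Subset n ] RankIndependent S K × (T ≡ map (restrict K) S)

CannotChange : ∀ {n} → (System n → System n → Set) → System n → Set
CannotChange R S = ∀ T → R S T → T ↭ S

Irreducible : ∀ {n} → System n → Set
Irreducible S = CannotChange Rule1Step S × CannotChange Rule2Step S

-- Rule 1 fires exactly when two equations have the same index set I_j, and each
-- application shortens the system; so after Rule 1 is exhausted the index sets are
-- pairwise distinct. Rule 2 restricts every I_j to a maximal independent set K of
-- columns, and this keeps distinct index sets distinct: if rows p ≠ q agree on K,
-- say c ∈ p ∖ q, then c ∉ K and K ∪ {c} is still independent, because a column set
-- containing c meets p and q in sizes differing by one, so one of the two is odd.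
-- That contradicts the maximality of ∣K∣. Hence the final system admits no Rule 1 step.
module Submission where

open import Defs
open import Data.Nat using (ℕ)
open import Relation.Binary.Construct.Closure.ReflexiveTransitive using (Star)

open import Level using (Level)
open import Data.Bool using (true; false; _xor_; not)
open import Data.Nat using (zero; suc; _+_; _%_; _≤_; _<_; _<ᵇ_; s≤s; z≤n)
open import Data.Nat.Properties
  using (1+n≰n; <-irrefl; n<1+n; +-monoˡ-≤; module ≤-Reasoning)
open import Data.Fin using (Fin; zero; suc; _≟_)
open import Data.Fin.Subset
  using (Subset; _∈_; _∉_; _⊆_; _∩_; _∪_; ⁅_⁆; ∣_∣; inside; outside)
open import Data.Fin.Subset.Properties
  using (_∈?_; ⊆-antisym; ∪-identityʳ; drop-not-there; x∈⁅x⁆; x∈⁅y⁆⇒x≡y;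
         x∈p∩q⁺; x∈p∩q⁻; x∈p∪q⁺; x∈p∪q⁻)
open import Data.Vec using (_∷_; here)
open import Data.List using ([]; _∷_; _++_; length)
open import Data.List.Properties using (length-++)
open import Data.List.Relation.Unary.All as All using (All; []; _∷_)
open import Data.List.Relation.Unary.AllPairs using (AllPairs; []; _∷_)
import Data.List.Relation.Unary.AllPairs.Properties as AllPairs
open import Data.List.Membership.Propositional using (lose) renaming (_∈_ to _∈ₗ_)
open import Data.List.Membership.Propositional.Properties using (∈-∃++)
open import Data.List.Relation.Binary.Permutation.Propositional
  using (_↭_; prep; ↭-refl; ↭-sym; ↭-trans; ↭⇒↭ₛ)
open import Data.List.Relation.Binary.Permutation.Propositional.Properties
  using (↭-length; shift)
import Data.List.Relation.Binary.Permutation.Setoid.Properties as Perm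
open import Data.Product using (_,_; proj₁)
open import Data.Sum using (_⊎_; inj₁; inj₂; [_,_])
open import Data.Empty using (⊥-elim)
open import Function using (_on_; _∘_; id; case_of_)
open import Relation.Nullary using (¬_; yes; no)
open import Relation.Unary using (Pred)
open import Relation.Binary using (Rel)
open import Relation.Binary.PropositionalEquality
  using (_≡_; _≢_; refl; sym; trans; cong; subst; resp₂; setoid)
open import Relation.Binary.Construct.Closure.ReflexiveTransitive using (fold)

private
  variable
    a ℓ ℓ′ p : Level
    A : Set a
    n : ℕ

odd⊎odd-suc : ∀ k → k % 2 ≡ 1 ⊎ suc k % 2 ≡ 1
odd⊎odd-suc zero = inj₂ refl
odd⊎odd-suc (suc zero) = inj₁ refl
odd⊎odd-suc (suc (suc k)) = odd⊎odd-suc k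

∣p∪⁅x⁆∣≡1+∣p∣ : {x : Fin n} {p : Subset n} → x ∉ p → ∣ p ∪ ⁅ x ⁆ ∣ ≡ suc ∣ p ∣
∣p∪⁅x⁆∣≡1+∣p∣ {x = zero} {inside ∷ p} x∉p = ⊥-elim (x∉p here)
∣p∪⁅x⁆∣≡1+∣p∣ {x = zero} {outside ∷ p} x∉p = cong (suc ∘ ∣_∣) (∪-identityʳ p)
∣p∪⁅x⁆∣≡1+∣p∣ {x = suc x} {inside ∷ p} x∉p = cong suc (∣p∪⁅x⁆∣≡1+∣p∣ (drop-not-there x∉p))
∣p∪⁅x⁆∣≡1+∣p∣ {x = suc x} {outside ∷ p} x∉p = ∣p∪⁅x⁆∣≡1+∣p∣ (drop-not-there x∉p)

∈-agree-on : {p q r : Subset n} {x : Fin n} → p ∩ r ≡ q ∩ r → x ∈ r → x ∈ p → x ∈ q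
∈-agree-on {q = q} {r} p∩r≡q∩r x∈r x∈p =
  proj₁ (x∈p∩q⁻ q r (subst (_ ∈_) p∩r≡q∩r (x∈p∩q⁺ (x∈p , x∈r))))

module _ {S : System n} {K : Subset n} {e f : Equation n}
         (e∈S : e ∈ₗ S) (f∈S : f ∈ₗ S) (agree : I e ∩ K ≡ I f ∩ K) where

  Independent-∪⁅c⁆ : ∀ {c} → Independent S K → c ∈ I e → c ∉ I f →
                     Independent S (K ∪ ⁅ c ⁆)
  Independent-∪⁅c⁆ {c} indK c∈e c∉f L L⊆K∪c nonempty = case c ∈? L of λ where
      (no c∉L) → indK L (λ x∈L → ∈K x∈L (λ { refl → c∉L x∈L })) nonempty
      (yes c∈L) →
        [ odd-row f∈S , odd-row e∈S ∘ subst (λ k → k % 2 ≡ 1) (sym (∣e∩L∣≡1+∣f∩L∣ c∈L)) ]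
          (odd⊎odd-suc ∣ I f ∩ L ∣)
    where
    odd-row : ∀ {g} → g ∈ₗ S → ∣ I g ∩ L ∣ % 2 ≡ 1 → SumNonzero S L
    odd-row = lose

    ∈K : ∀ {x} → x ∈ L → x ≢ c → x ∈ K
    ∈K x∈L x≢c = [ id , (λ x∈⁅c⁆ → ⊥-elim (x≢c (x∈⁅y⁆⇒x≡y c x∈⁅c⁆))) ]
                   (x∈p∪q⁻ K ⁅ c ⁆ (L⊆K∪c x∈L))

    e∩L⊆f∩L∪c : c ∈ L → I e ∩ L ⊆ (I f ∩ L) ∪ ⁅ c ⁆
    e∩L⊆f∩L∪c c∈L {x} x∈e∩L with x∈p∩q⁻ (I e) L x∈e∩L | x ≟ c
    ... | _ , _ | yes refl = x∈p∪q⁺ (inj₂ (x∈⁅x⁆ c))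
    ... | x∈e , x∈L | no x≢c =
      x∈p∪q⁺ (inj₁ (x∈p∩q⁺ (∈-agree-on agree (∈K x∈L x≢c) x∈e , x∈L)))

    f∩L∪c⊆e∩L : c ∈ L → (I f ∩ L) ∪ ⁅ c ⁆ ⊆ I e ∩ L
    f∩L∪c⊆e∩L c∈L {x} x∈ with x∈p∪q⁻ (I f ∩ L) ⁅ c ⁆ x∈
    ... | inj₂ x∈⁅c⁆ with refl ← x∈⁅y⁆⇒x≡y c x∈⁅c⁆ = x∈p∩q⁺ (c∈e , c∈L)
    ... | inj₁ x∈f∩L with x∈f , x∈L ← x∈p∩q⁻ (I f) L x∈f∩L =
      x∈p∩q⁺ (∈-agree-on (sym agree) (∈K x∈L (λ { refl → c∉f x∈f })) x∈f , x∈L)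

    ∣e∩L∣≡1+∣f∩L∣ : c ∈ L → ∣ I e ∩ L ∣ ≡ suc ∣ I f ∩ L ∣
    ∣e∩L∣≡1+∣f∩L∣ c∈L = trans (cong ∣_∣ (⊆-antisym (e∩L⊆f∩L∪c c∈L) (f∩L∪c⊆e∩L c∈L)))
                              (∣p∪⁅x⁆∣≡1+∣p∣ (c∉f ∘ proj₁ ∘ x∈p∩q⁻ (I f) L))

  RankIndependent-agree⇒⊆ : RankIndependent S K → I e ⊆ I f
  RankIndependent-agree⇒⊆ (indK , maxK) {c} c∈e with c ∈? I f
  ... | yes c∈f = c∈f
  ... | no c∉f = ⊥-elim (1+n≰n (subst (_≤ ∣ K ∣) (∣p∪⁅x⁆∣≡1+∣p∣ c∉K)
                          (maxK _ (Independent-∪⁅c⁆ indK c∈e c∉f))))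
    where
    c∉K : c ∉ K
    c∉K c∈K = c∉f (∈-agree-on agree c∈K c∈e)

RankIndependent-agree⇒≡ : {S : System n} {K : Subset n} {e f : Equation n} →
                          RankIndependent S K → e ∈ₗ S → f ∈ₗ S →
                          I e ∩ K ≡ I f ∩ K → I e ≡ I f
RankIndependent-agree⇒≡ rank e∈S f∈S agree =
  ⊆-antisym (RankIndependent-agree⇒⊆ e∈S f∈S agree rank)
            (RankIndependent-agree⇒⊆ f∈S e∈S (sym agree) rank)

module _ {R : Rel A ℓ} where

  AllPairs-from-↭ : ∀ xs → (∀ {x y zs} → xs ↭ x ∷ y ∷ zs → R x y) → AllPairs R xs
  AllPairs-from-↭ [] _ = []
  AllPairs-from-↭ (x ∷ xs) R-on-front = All.tabulate R-x ∷ AllPairs-from-↭ xs R-on-tail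
    where
    R-x : ∀ {y} → y ∈ₗ xs → R x y
    R-x y∈xs with ys , zs , refl ← ∈-∃++ y∈xs = R-on-front (prep x (shift _ ys zs))
    R-on-tail : ∀ {y z zs} → xs ↭ y ∷ z ∷ zs → R y z
    R-on-tail {y} {z} {zs} p =
      R-on-front (↭-trans (prep x p) (↭-sym (shift x (y ∷ z ∷ []) zs)))

  AllPairs-weaken-on : {P : Pred A p} {R′ : Rel A ℓ′} →
                       (∀ {x y} → P x → P y → R x y → R′ x y) →
                       ∀ {xs} → All P xs → AllPairs R xs → AllPairs R′ xs
  AllPairs-weaken-on weaken [] [] = []
  AllPairs-weaken-on weaken (px ∷ pxs) (rx ∷ rxs) =
    All.zipWith (λ (py , r) → weaken px py r) (pxs , rx) ∷ AllPairs-weaken-on weaken pxs rxs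

Star-preserves : {T : Rel A ℓ} {P : Pred A p} → (∀ {x y} → T x y → P x → P y) →
                 ∀ {x y} → Star T x y → P x → P y
Star-preserves {P = P} preserves =
  fold (λ x y → P x → P y) (λ step rest → rest ∘ preserves step) id

DistinctIndexSets : System n → Set
DistinctIndexSets = AllPairs (_≢_ on I)

DistinctIndexSets-resp-↭ : {S T : System n} → S ↭ T → DistinctIndexSets S → DistinctIndexSets T
DistinctIndexSets-resp-↭ {n} S↭T =
  Perm.AllPairs-resp-↭ (setoid (Equation n)) (_∘ sym) (resp₂ (_≢_ on I)) (↭⇒↭ₛ S↭T)

Rule2Step-DistinctIndexSets : {S T : System n} → Rule2Step S T →
                              DistinctIndexSets S → DistinctIndexSets T
Rule2Step-DistinctIndexSets (K , rank , refl) distinct =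
  AllPairs.map⁺ (AllPairs-weaken-on
    (λ e∈S f∈S Ie≢If → Ie≢If ∘ RankIndependent-agree⇒≡ rank e∈S f∈S)
    (All.tabulate id) distinct)

combine-length≤1 : (e f : Equation n) → length (combine e f) ≤ 1
combine-length≤1 (eqn _ b₁ w₁) (eqn _ b₂ w₂) with not (b₁ xor b₂) | w₂ <ᵇ w₁ | w₁ <ᵇ w₂
... | true  | _     | _     = s≤s z≤n
... | false | true  | _     = s≤s z≤n
... | false | false | true  = s≤s z≤n
... | false | false | false = z≤n

Rule1Step-length< : {S T : System n} → Rule1Step S T → length T < length S
Rule1Step-length< {S = S} {T} (e , f , R , S↭efR , _ , T↭cR) = begin-strict
  length T                        ≡⟨ ↭-length T↭cR ⟩
  length (combine e f ++ R)       ≡⟨ length-++ (combine e f) ⟩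
  length (combine e f) + length R ≤⟨ +-monoˡ-≤ (length R) (combine-length≤1 e f) ⟩
  suc (length R)                  <⟨ n<1+n _ ⟩
  length (e ∷ f ∷ R)              ≡⟨ ↭-length (↭-sym S↭efR) ⟩
  length S                        ∎
  where open ≤-Reasoning

CannotChange-Rule1⇒DistinctIndexSets : {S : System n} → CannotChange Rule1Step S →
                                       DistinctIndexSets S
CannotChange-Rule1⇒DistinctIndexSets {S = S} stuck = AllPairs-from-↭ S λ S↭efR Ie≡If →
  let step = _ , _ , _ , S↭efR , Ie≡If , ↭-refl
  in <-irrefl (↭-length (stuck _ step)) (Rule1Step-length< step)

DistinctIndexSets⇒¬Rule1Step : {S T : System n} → DistinctIndexSets S → ¬ Rule1Step S T
DistinctIndexSets⇒¬Rule1Step distinct (_ , _ , _ , S↭efR , Ie≡If , _)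
  with (Ie≢If ∷ _) ∷ _ ← DistinctIndexSets-resp-↭ S↭efR distinct = Ie≢If Ie≡If

lemma2 : (n : ℕ) (S S₁ S' : System n) → WellFormed S →
         Star Rule1Step S S₁ → CannotChange Rule1Step S₁ →
         Star Rule2Step S₁ S' → CannotChange Rule2Step S' →
         Irreducible S'
lemma2 n S S₁ S' _ _ rule1-stuck rule2-steps rule2-stuck =
  (λ T step → ⊥-elim (DistinctIndexSets⇒¬Rule1Step distinct′ step)) , rule2-stuck
  where
  distinct′ : DistinctIndexSets S'
  distinct′ = Star-preserves Rule2Step-DistinctIndexSets rule2-steps
                (CannotChange-Rule1⇒DistinctIndexSets rule1-stuck)
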